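{- Let $G=(V,E)$ be a directed graph, let $v\in V$ and let $T\subseteq V$ be such that $T$ induces an almost top SCC with respect to $v$ in $G$. Let $W=V\setminus(T\cup\{v\})$. If $W\neq\emptyset$, then there do not exist two internally vertex-disjoint paths in $G$ from any vertex of $W$ to any vertex of $T$; i.e., no vertex of $W$ is 2-vertex strongly connected to any vertex of $T$. Additionally, $v$ is a vertex-dominator in the flow graph $G(r)$ for every $r\in W$ that can reach $v$ in $G$.
   Context: For a graph $H$ and a vertex set $X$, $H\setminus X$ is the subgraph induced by the remaining vertices. A top SCC (tSCC) of a graph is a strongly connected component with no incoming edges from vertices outside it. A set $T$ induces an almost tSCC with respect to a vertex $v$ in $G$ if $G[T]$ is a tSCC of $G\setminus\{v\}$ but $T$ has at least one incoming edge from $v$ in $G$. The flow graph $G(r)$ is $G$ with designated root $r$ and all vertices not reachable from $r$ removed. A vertex $v\neq r$ is a vertex-dominator in $G(r)$ if there is a vertex $u\notin\{r,v\}$ reachable from $r$ such that every path from $r$ to $u$ contains $v$. Two distinct vertices $u,w$ are 2-vertex strongly connected in $G$ if they are strongly connected and remain so after removal of any single vertex other than $u,w$. Paths are internally vertex-disjoint if they share no vertices other than possibly their endpoints. -}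

module Defs where

open import Data.Nat using (ℕ)
open import Data.Fin using (Fin)
open import Data.List using (List; []; _∷_)
open import Data.List.Membership.Propositional using (_∈_)
open import Data.List.Relation.Unary.All using (All)
open import Data.List.Relation.Unary.Unique.Propositional using (Unique)
open import Data.Product using (Σ; _×_; ∃; ∃-syntax)
open import Data.Empty using (⊥)
open import Relation.Nullary using (¬_)
open import Relation.Binary.PropositionalEquality using (_≡_; _≢_)

Graph : ℕ → Set₁
Graph n = Fin n → Fin n → Set

data Walk {n : ℕ} (E : Graph n) : Fin n → Fin n → Set where
  [_]  : (x : Fin n) → Walk E x x
  step : (x : Fin n) {y z : Fin n} → E x y → Walk E y z → Walk E x z

module _ {n : ℕ} {E : Graph n} where

  verts : ∀ {x y} → Walk E x y → List (Fin n)
  verts [ x ]          = x ∷ []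
  verts (step x _ p)   = x ∷ verts p

  initVerts : ∀ {x y} → Walk E x y → List (Fin n)
  initVerts [ x ]        = []
  initVerts (step x _ p) = x ∷ initVerts p

  interior : ∀ {x y} → Walk E x y → List (Fin n)
  interior [ x ]        = []
  interior (step x _ p) = initVerts p

IsPath : ∀ {n} {E : Graph n} {x y : Fin n} → Walk E x y → Set
IsPath p = Unique (verts p)

ReachAvoid : ∀ {n} → Graph n → (Fin n → Set) → Fin n → Fin n → Set
ReachAvoid E X x y = Σ (Walk E x y) λ p → IsPath p × All (λ z → ¬ X z) (verts p)

Reach : ∀ {n} → Graph n → Fin n → Fin n → Set
Reach E x y = Σ (Walk E x y) IsPath

IsTopSCCMinus : ∀ {n} → Graph n → Fin n → (Fin n → Set) → Set
IsTopSCCMinus {n} E v T =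
    (∀ t → T t → t ≢ v)
  × (∃[ t ] T t)
  × (∀ a b → T a → T b → ReachAvoid E (_≡ v) a b)
  × (∀ a b → T a → b ≢ v → ReachAvoid E (_≡ v) a b → ReachAvoid E (_≡ v) b a → T b)
  × (∀ x t → ¬ T x → x ≢ v → T t → ¬ E x t)

AlmostTopSCC : ∀ {n} → Graph n → Fin n → (Fin n → Set) → Set
AlmostTopSCC E v T = IsTopSCCMinus E v T × (∃[ t ] (T t × E v t))

TwoDisjointPaths : ∀ {n} → Graph n → Fin n → Fin n → Set
TwoDisjointPaths {n} E x y =
  Σ (Walk E x y) λ p → Σ (Walk E x y) λ q →
    IsPath p × IsPath q × p ≢ q ×
    (∀ z → z ∈ interior p → z ∈ interior q → ⊥)

TwoVSC : ∀ {n} → Graph n → Fin n → Fin n → Set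
TwoVSC E u w =
    u ≢ w
  × Reach E u w × Reach E w u
  × (∀ x → x ≢ u → x ≢ w → ReachAvoid E (_≡ x) u w × ReachAvoid E (_≡ x) w u)

-- v is a vertex-dominator in the flow graph G(r).
-- (G(r) contains exactly the vertices reachable from r; paths from r lie in G(r).)
VertexDominator : ∀ {n} → Graph n → Fin n → Fin n → Set
VertexDominator E r v =
    v ≢ r
  × Reach E r v
  × (∃[ u ] (u ≢ r × u ≢ v × Reach E r u
             × (∀ (p : Walk E r u) → IsPath p → v ∈ verts p)))

-- T receives no edge from outside T ∪ {v}, so every walk entering T from outside
-- passes through v strictly before its last vertex. Hence v is an internal vertex of
-- every path from W to T, and removing v separates W from T. For a root r ∈ W, a path
-- from r to v never meets T, so it extends by an edge v → t into a path to t ∈ T,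
-- and every path from r to t goes through v.
module Submission where

open import Defs
open import Data.Nat using (ℕ)
open import Data.Fin using (Fin; _≟_)
open import Data.Product using (_×_; ∃-syntax; _,_; proj₁)
open import Data.List using ([]; _∷_; _++_)
open import Data.List.Membership.Propositional using (_∈_; _∉_)
open import Data.List.Relation.Unary.Any using (here; there)
open import Data.List.Relation.Unary.All using (All; []; _∷_; lookup)
open import Data.List.Relation.Unary.AllPairs using ([]; _∷_)
open import Data.List.Relation.Unary.Unique.Propositional.Properties using (++⁺)
open import Data.Empty using (⊥-elim)
open import Relation.Nullary using (¬_; yes; no)
open import Relation.Binary.PropositionalEquality using (_≡_; _≢_; refl; sym; subst)

module _ {n : ℕ} {E : Graph n} where

  initVerts⊆verts : ∀ {x y z} (p : Walk E x y) → z ∈ initVerts p → z ∈ verts p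
  initVerts⊆verts (step x e p) (here eq) = here eq
  initVerts⊆verts (step x e p) (there m) = there (initVerts⊆verts p m)

  last∈verts : ∀ {x y} (p : Walk E x y) → y ∈ verts p
  last∈verts [ x ]        = here refl
  last∈verts (step x e p) = there (last∈verts p)

  initVerts⇒interior : ∀ {x y z} (p : Walk E x y) → z ≢ x → z ∈ initVerts p → z ∈ interior p
  initVerts⇒interior (step x e p) z≢x (here eq) = ⊥-elim (z≢x eq)
  initVerts⇒interior (step x e p) z≢x (there m) = m

  snoc : ∀ {x y z} → Walk E x y → E y z → Walk E x z
  snoc [ x ]         e = step x e [ _ ]
  snoc (step x e' p) e = step x e' (snoc p e)

  verts-snoc : ∀ {x y z} (p : Walk E x y) (e : E y z) → verts (snoc p e) ≡ verts p ++ z ∷ []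
  verts-snoc [ x ]         e = refl
  verts-snoc (step x e' p) e rewrite verts-snoc p e = refl

  snoc-isPath : ∀ {x y z} (p : Walk E x y) (e : E y z) → IsPath p → z ∉ verts p → IsPath (snoc p e)
  snoc-isPath {z = z} p e p-path z∉p rewrite verts-snoc p e =
    ++⁺ p-path ([] ∷ []) λ { (z∈p , here refl) → z∉p z∈p }

module EnteredOnlyVia {n : ℕ} (E : Graph n) (v : Fin n) (T : Fin n → Set)
         (no-entry : ∀ x t → ¬ T x → x ≢ v → T t → ¬ E x t) where

  entering-walk-visits : ∀ {x y} (p : Walk E x y) → ¬ T x → T y → v ∈ initVerts p
  entering-walk-visits [ x ] ¬Tx Tx = ⊥-elim (¬Tx Tx)
  entering-walk-visits (step x {y} e p) ¬Tx Tz with x ≟ v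
  ... | yes refl = here refl
  ... | no x≢v   = there (entering-walk-visits p (λ Ty → no-entry x y ¬Tx x≢v Ty e) Tz)

  entering-path-through : ∀ {x y} (p : Walk E x y) → ¬ T x → x ≢ v → T y → v ∈ interior p
  entering-path-through p ¬Tx x≢v Ty =
    initVerts⇒interior p (λ v≡x → x≢v (sym v≡x)) (entering-walk-visits p ¬Tx Ty)

  path-to-v-outside : ∀ {x} (p : Walk E x v) → IsPath p → ¬ T x → All (λ z → ¬ T z) (verts p)
  path-to-v-outside [ x ]            _          ¬Tx = ¬Tx ∷ []
  path-to-v-outside (step x {y} e p) (x∉p ∷ p-path) ¬Tx =
    ¬Tx ∷ path-to-v-outside p p-path (λ Ty → no-entry x y ¬Tx x≢v Ty e)
    where
      x≢v : x ≢ v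
      x≢v = lookup x∉p (last∈verts p)

  extend-path-into : ∀ {x t} (p : Walk E x v) → IsPath p → ¬ T x → (e : E v t) → T t →
                     IsPath (snoc p e)
  extend-path-into p p-path ¬Tx e Tt = snoc-isPath p e p-path λ t∈p →
    lookup (path-to-v-outside p p-path ¬Tx) t∈p Tt

mainTheorem4 : {n : ℕ} (E : Graph n) (v : Fin n) (T : Fin n → Set) →
    AlmostTopSCC E v T →
    (∃[ w ] (¬ T w × w ≢ v)) →
    ((∀ w t → ¬ T w → w ≢ v → T t → ¬ TwoDisjointPaths E w t)
     × (∀ w t → ¬ T w → w ≢ v → T t → ¬ TwoVSC E w t))
    × (∀ r → ¬ T r → r ≢ v → Reach E r v → VertexDominator E r v)
mainTheorem4 E v T ((T∌v , _ , _ , _ , no-entry) , (t , Tt , v→t)) _ =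
  (no-two-disjoint-paths , not-2vsc) , dominates
  where
    open EnteredOnlyVia E v T no-entry

    no-two-disjoint-paths : ∀ w t → ¬ T w → w ≢ v → T t → ¬ TwoDisjointPaths E w t
    no-two-disjoint-paths w t ¬Tw w≢v Tt (p , q , _ , _ , _ , disjoint) =
      disjoint v (entering-path-through p ¬Tw w≢v Tt) (entering-path-through q ¬Tw w≢v Tt)

    not-2vsc : ∀ w t → ¬ T w → w ≢ v → T t → ¬ TwoVSC E w t
    not-2vsc w t ¬Tw w≢v Tt (_ , _ , _ , robust) =
      let p , _ , p-avoids-v = proj₁ (robust v (λ v≡w → w≢v (sym v≡w)) (λ v≡t → T∌v t Tt (sym v≡t)))
      in lookup p-avoids-v (initVerts⊆verts p (entering-walk-visits p ¬Tw Tt)) refl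

    dominates : ∀ r → ¬ T r → r ≢ v → Reach E r v → VertexDominator E r v
    dominates r ¬Tr r≢v (p , p-path) =
        (λ v≡r → r≢v (sym v≡r))
      , (p , p-path)
      , ( t , (λ t≡r → ¬Tr (subst T t≡r Tt)) , T∌v t Tt
        , (snoc p v→t , extend-path-into p p-path ¬Tr v→t Tt)
        , λ q _ → initVerts⊆verts q (entering-walk-visits q ¬Tr Tt))
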